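{- For all integers $n\geq0$, $V^{(2n+1)}(z)=A_n(W(z))$, where $A_n(X)$ is a polynomial of degree $2n+3$ in $\mathbb{Z}[X]$.
   Context: $D$ is a non-zero rational integer, $\mathcal{L}$ a lattice such that $\wp'(z,\mathcal{L})^2=4\wp(z,\mathcal{L})^3-4D\wp(z,\mathcal{L})$. $W(z)=\wp(z,\mathcal{L})^{1/2}$ and $V(z)=(\wp(z,\mathcal{L})^2-D)^{1/2}$ are (formal, locally chosen) square roots, with branches compatible so that $\wp'(z,\mathcal{L})=2W(z)V(z)$; consequently $W'=V$ and $V'=2W^3$. $V^{(m)}$ denotes the $m$-th derivative in $z$. -}

module Defs where

open import Level using (_⊔_)
open import Data.Nat using (ℕ; zero; suc)
open import Data.Integer using (ℤ; +_; -[1+_])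
open import Data.List using (List; []; _∷_; length; last)
open import Data.Maybe using (Maybe; just)
open import Algebra.Bundles using (CommutativeRing)
open import Relation.Binary.PropositionalEquality using (_≡_)
open import Relation.Nullary using (¬_)
open import Data.Product using (_×_; Σ)

-- Polynomials in ℤ[X] as coefficient lists, constant coefficient first.
Poly : Set
Poly = List ℤ

HasDegree : Poly → ℕ → Set
HasDegree A d = (length A ≡ suc d) × Σ ℤ (λ a → (last A ≡ just a) × ¬ (a ≡ + 0))

iter : ∀ {a} {A : Set a} → ℕ → (A → A) → A → A
iter zero    f x = x
iter (suc n) f x = f (iter n f x)

module _ {c ℓ} (R : CommutativeRing c ℓ) where
  open CommutativeRing R

  natR : ℕ → Carrier
  natR zero    = 0#
  natR (suc n) = 1# + natR n

  intR : ℤ → Carrier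
  intR (+ n)     = natR n
  intR -[1+ n ]  = - natR (suc n)

  evalPoly : Poly → Carrier → Carrier
  evalPoly []      x = 0#
  evalPoly (a ∷ A) x = intR a + x * evalPoly A x

  record IsDerivation (∂ : Carrier → Carrier) : Set (c ⊔ ℓ) where
    field
      ∂-cong    : ∀ {x y} → x ≈ y → ∂ x ≈ ∂ y
      ∂-+       : ∀ x y → ∂ (x + y) ≈ ∂ x + ∂ y
      ∂-leibniz : ∀ x y → ∂ (x * y) ≈ ∂ x * y + x * ∂ y

-- Differentiating P(W) gives P′(W)·V, and differentiating once more brings the result back
-- to a polynomial in W, since V² = W⁴ − D and ∂V = 2W³:
-- ∂²(P(W)) = ((X⁴ − D) P″ + 2X³ P′)(W). Starting from ∂V = 2W³ this gives V^(2n+1) = A_n(W)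
-- with A_0 = 2X³ and A_(n+1) = (X⁴ − D) A_n″ + 2X³ A_n′. If P has degree e ≥ 2 and leading
-- coefficient a, the coefficient of X^(e+2) in (X⁴ − D) P″ + 2X³ P′ is e(e−1)a + 2ea = e(e+1)a ≠ 0,
-- so each step raises the degree by exactly 2.
module Submission where

open import Defs
open import Data.Nat using (ℕ; zero; suc; pred; _⊔_; _≤_; s≤s) renaming (_+_ to _+ℕ_; _*_ to _*ℕ_)
import Data.Nat.Properties as ℕP
open import Data.Integer as ℤ using (ℤ; +_; -[1+_]; _⊖_)
import Data.Integer.Properties as ℤP
open import Data.List using ([]; _∷_; length; last; map; replicate; _++_)
open import Data.List.Properties using (length-map; length-++; length-replicate)
open import Data.Maybe using (just)
open import Data.Maybe.Properties using (just-injective)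
open import Data.Product using (Σ; _×_; _,_)
open import Data.Sum using (inj₁; inj₂)
open import Relation.Binary.PropositionalEquality as ≡ using (_≡_; _≢_)
open import Relation.Nullary using (¬_)
open import Algebra.Bundles using (CommutativeRing)

infixl 6 _+ₚ_
infixr 7 _·ₚ_
infixr 8 X^_*_

_+ₚ_ : Poly → Poly → Poly
[]      +ₚ q       = q
(a ∷ p) +ₚ []      = a ∷ p
(a ∷ p) +ₚ (b ∷ q) = a ℤ.+ b ∷ p +ₚ q

_·ₚ_ : ℤ → Poly → Poly
c ·ₚ p = map (c ℤ.*_) p

X^_*_ : ℕ → Poly → Poly
X^ k * p = replicate k (+ 0) ++ p

derivativeFrom : ℕ → Poly → Poly
derivativeFrom k []      = []
derivativeFrom k (a ∷ p) = + k ℤ.* a ∷ derivativeFrom (suc k) p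

derivative : Poly → Poly
derivative []      = []
derivative (_ ∷ p) = derivativeFrom 1 p

secondDerivative : ℤ → Poly → Poly
secondDerivative D P = X^ 4 * P″ +ₚ (ℤ.- D ·ₚ P″ +ₚ + 2 ·ₚ X^ 3 * P′)
  where
  P′ P″ : Poly
  P′ = derivative P
  P″ = derivative P′

A : ℤ → ℕ → Poly
A D zero    = X^ 3 * (+ 2 ∷ [])
A D (suc n) = secondDerivative D (A D n)

coeff : Poly → ℕ → ℤ
coeff []      _       = + 0
coeff (a ∷ p) zero    = a
coeff (a ∷ p) (suc k) = coeff p k

coeff-+ₚ : ∀ p q k → coeff (p +ₚ q) k ≡ coeff p k ℤ.+ coeff q k
coeff-+ₚ []      q       k       = ≡.sym (ℤP.+-identityˡ _)
coeff-+ₚ (a ∷ p) []      k       = ≡.sym (ℤP.+-identityʳ _)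
coeff-+ₚ (a ∷ p) (b ∷ q) zero    = ≡.refl
coeff-+ₚ (a ∷ p) (b ∷ q) (suc k) = coeff-+ₚ p q k

coeff-·ₚ : ∀ c p k → coeff (c ·ₚ p) k ≡ c ℤ.* coeff p k
coeff-·ₚ c []      k       = ≡.sym (ℤP.*-zeroʳ c)
coeff-·ₚ c (a ∷ p) zero    = ≡.refl
coeff-·ₚ c (a ∷ p) (suc k) = coeff-·ₚ c p k

coeff-X^ : ∀ k p i → coeff (X^ k * p) (k +ℕ i) ≡ coeff p i
coeff-X^ zero    p i = ≡.refl
coeff-X^ (suc k) p i = coeff-X^ k p i

coeff-derivativeFrom : ∀ m p k → coeff (derivativeFrom m p) k ≡ + (m +ℕ k) ℤ.* coeff p k
coeff-derivativeFrom m []      k       = ≡.sym (ℤP.*-zeroʳ (+ (m +ℕ k)))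
coeff-derivativeFrom m (a ∷ p) zero    = ≡.cong (λ j → + j ℤ.* a) (≡.sym (ℕP.+-identityʳ m))
coeff-derivativeFrom m (a ∷ p) (suc k) =
  ≡.trans (coeff-derivativeFrom (suc m) p k) (≡.cong (λ j → + j ℤ.* coeff p k) (≡.sym (ℕP.+-suc m k)))

coeff-derivative : ∀ p k → coeff (derivative p) k ≡ + suc k ℤ.* coeff p (suc k)
coeff-derivative []      k = ≡.sym (ℤP.*-zeroʳ (+ suc k))
coeff-derivative (a ∷ p) k = coeff-derivativeFrom 1 p k

coeff-≥-length : ∀ p {k} → length p ≤ k → coeff p k ≡ + 0
coeff-≥-length []      _       = ≡.refl
coeff-≥-length (a ∷ p) (s≤s h) = coeff-≥-length p h

last≡just-coeff : ∀ p {d} → length p ≡ suc d → last p ≡ just (coeff p d)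
last≡just-coeff (a ∷ [])    {zero}  _ = ≡.refl
last≡just-coeff (a ∷ b ∷ p) {suc d} h = last≡just-coeff (b ∷ p) (ℕP.suc-injective h)

length-+ₚ : ∀ p q → length (p +ₚ q) ≡ length p ⊔ length q
length-+ₚ []      q       = ≡.refl
length-+ₚ (a ∷ p) []      = ≡.refl
length-+ₚ (a ∷ p) (b ∷ q) = ≡.cong suc (length-+ₚ p q)

length-·ₚ : ∀ c p → length (c ·ₚ p) ≡ length p
length-·ₚ c p = length-map (c ℤ.*_) p

length-X^ : ∀ k p → length (X^ k * p) ≡ k +ℕ length p
length-X^ k p = ≡.trans (length-++ (replicate k (+ 0))) (≡.cong (_+ℕ length p) (length-replicate k))

length-derivativeFrom : ∀ m p → length (derivativeFrom m p) ≡ length p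
length-derivativeFrom m []      = ≡.refl
length-derivativeFrom m (a ∷ p) = ≡.cong suc (length-derivativeFrom (suc m) p)

length-derivative : ∀ p → length (derivative p) ≡ pred (length p)
length-derivative []      = ≡.refl
length-derivative (a ∷ p) = length-derivativeFrom 1 p

module _ (D : ℤ) (P : Poly) {d : ℕ} (length-P : length P ≡ 3 +ℕ d) where

  private
    P′ P″ : Poly
    P′ = derivative P
    P″ = derivative P′

    length-P′ : length P′ ≡ 2 +ℕ d
    length-P′ = ≡.trans (length-derivative P) (≡.cong pred length-P)

    length-P″ : length P″ ≡ 1 +ℕ d
    length-P″ = ≡.trans (length-derivative P′) (≡.cong pred length-P′)

  length-secondDerivative : length (secondDerivative D P) ≡ 5 +ℕ d
  length-secondDerivative = begin
    length (secondDerivative D P)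
      ≡⟨ length-+ₚ (X^ 4 * P″) (ℤ.- D ·ₚ P″ +ₚ + 2 ·ₚ X^ 3 * P′) ⟩
    length (X^ 4 * P″) ⊔ length (ℤ.- D ·ₚ P″ +ₚ + 2 ·ₚ X^ 3 * P′)
      ≡⟨ ≡.cong (length (X^ 4 * P″) ⊔_) (length-+ₚ (ℤ.- D ·ₚ P″) (+ 2 ·ₚ X^ 3 * P′)) ⟩
    length (X^ 4 * P″) ⊔ (length (ℤ.- D ·ₚ P″) ⊔ length (+ 2 ·ₚ X^ 3 * P′))
      ≡⟨ ≡.cong₂ (λ l l′ → l ⊔ (length (ℤ.- D ·ₚ P″) ⊔ l′))
           (≡.trans (length-X^ 4 P″) (≡.cong (4 +ℕ_) length-P″))
           (≡.trans (length-·ₚ (+ 2) (X^ 3 * P′)) (≡.trans (length-X^ 3 P′) (≡.cong (3 +ℕ_) length-P′))) ⟩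
    (5 +ℕ d) ⊔ (length (ℤ.- D ·ₚ P″) ⊔ (5 +ℕ d))
      ≡⟨ ≡.cong (λ l → (5 +ℕ d) ⊔ (l ⊔ (5 +ℕ d))) (≡.trans (length-·ₚ (ℤ.- D) P″) length-P″) ⟩
    (5 +ℕ d) ⊔ ((1 +ℕ d) ⊔ (5 +ℕ d))
      ≡⟨ ≡.cong ((5 +ℕ d) ⊔_) (ℕP.m≤n⇒m⊔n≡n (ℕP.m≤n+m (1 +ℕ d) 4)) ⟩
    (5 +ℕ d) ⊔ (5 +ℕ d)
      ≡⟨ ℕP.⊔-idem (5 +ℕ d) ⟩
    5 +ℕ d ∎
    where open ≡.≡-Reasoning

  coeff-secondDerivative-leading :
    coeff (secondDerivative D P) (4 +ℕ d) ≡ + (3 +ℕ d) ℤ.* (+ (2 +ℕ d) ℤ.* coeff P (2 +ℕ d))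
  coeff-secondDerivative-leading = begin
    coeff (X^ 4 * P″ +ₚ (ℤ.- D ·ₚ P″ +ₚ + 2 ·ₚ X^ 3 * P′)) (4 +ℕ d)
      ≡⟨ coeff-+ₚ (X^ 4 * P″) (ℤ.- D ·ₚ P″ +ₚ + 2 ·ₚ X^ 3 * P′) (4 +ℕ d) ⟩
    coeff (X^ 4 * P″) (4 +ℕ d) ℤ.+ coeff (ℤ.- D ·ₚ P″ +ₚ + 2 ·ₚ X^ 3 * P′) (4 +ℕ d)
      ≡⟨ ≡.cong (λ u → coeff (X^ 4 * P″) (4 +ℕ d) ℤ.+ u) (coeff-+ₚ (ℤ.- D ·ₚ P″) (+ 2 ·ₚ X^ 3 * P′) (4 +ℕ d)) ⟩
    coeff (X^ 4 * P″) (4 +ℕ d) ℤ.+ (coeff (ℤ.- D ·ₚ P″) (4 +ℕ d) ℤ.+ coeff (+ 2 ·ₚ X^ 3 * P′) (4 +ℕ d))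
      ≡⟨ ≡.cong₂ ℤ._+_ (coeff-X^ 4 P″ d)
           (≡.cong₂ ℤ._+_ (coeff-·ₚ (ℤ.- D) P″ (4 +ℕ d)) (coeff-·ₚ (+ 2) (X^ 3 * P′) (4 +ℕ d))) ⟩
    coeff P″ d ℤ.+ (ℤ.- D ℤ.* coeff P″ (4 +ℕ d) ℤ.+ + 2 ℤ.* coeff (X^ 3 * P′) (3 +ℕ (1 +ℕ d)))
      ≡⟨ ≡.cong₂ (λ u v → coeff P″ d ℤ.+ (ℤ.- D ℤ.* u ℤ.+ + 2 ℤ.* v))
           (coeff-≥-length P″ (ℕP.≤-trans (ℕP.≤-reflexive length-P″) (ℕP.m≤n+m (1 +ℕ d) 3)))
           (coeff-X^ 3 P′ (1 +ℕ d)) ⟩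
    coeff P″ d ℤ.+ (ℤ.- D ℤ.* + 0 ℤ.+ + 2 ℤ.* y)
      ≡⟨ ≡.cong (λ u → coeff P″ d ℤ.+ u)
           (≡.trans (≡.cong (ℤ._+ + 2 ℤ.* y) (ℤP.*-zeroʳ (ℤ.- D))) (ℤP.+-identityˡ (+ 2 ℤ.* y))) ⟩
    coeff P″ d ℤ.+ + 2 ℤ.* y
      ≡⟨ ≡.cong (λ u → u ℤ.+ + 2 ℤ.* y) (coeff-derivative P′ d) ⟩
    + (1 +ℕ d) ℤ.* y ℤ.+ + 2 ℤ.* y
      ≡⟨ ℤP.*-distribʳ-+ y (+ (1 +ℕ d)) (+ 2) ⟨
    + (1 +ℕ d +ℕ 2) ℤ.* y
      ≡⟨ ≡.cong (λ k → + k ℤ.* y) (ℕP.+-comm (1 +ℕ d) 2) ⟩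
    + (3 +ℕ d) ℤ.* y
      ≡⟨ ≡.cong (+ (3 +ℕ d) ℤ.*_) (coeff-derivative P (1 +ℕ d)) ⟩
    + (3 +ℕ d) ℤ.* (+ (2 +ℕ d) ℤ.* coeff P (2 +ℕ d)) ∎
    where
    open ≡.≡-Reasoning
    y : ℤ
    y = coeff P′ (1 +ℕ d)

+[1+m]*i≢0 : ∀ m {i} → i ≢ + 0 → + suc m ℤ.* i ≢ + 0
+[1+m]*i≢0 m i≢0 eq with ℤP.i*j≡0⇒i≡0∨j≡0 (+ suc m) eq
... | inj₁ ()
... | inj₂ i≡0 = i≢0 i≡0

secondDerivative-degree : ∀ D P {d} → HasDegree P (2 +ℕ d) → HasDegree (secondDerivative D P) (4 +ℕ d)
secondDerivative-degree D P {d} (length-P , a , last-P , a≢0) =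
  length-secondDerivative D P length-P ,
  coeff T (4 +ℕ d) ,
  last≡just-coeff T (length-secondDerivative D P length-P) ,
  λ leading≡0 → +[1+m]*i≢0 (2 +ℕ d) (+[1+m]*i≢0 (1 +ℕ d) leading-P≢0)
                  (≡.trans (≡.sym (coeff-secondDerivative-leading D P length-P)) leading≡0)
  where
  T : Poly
  T = secondDerivative D P
  leading-P≢0 : coeff P (2 +ℕ d) ≢ + 0
  leading-P≢0 = ≡.subst (_≢ + 0) (just-injective (≡.trans (≡.sym last-P) (last≡just-coeff P length-P))) a≢0

A-degree : ∀ D n → HasDegree (A D n) (3 +ℕ 2 *ℕ n)
A-degree D zero    = ≡.refl , + 2 , ≡.refl , λ ()
A-degree D (suc n) = ≡.subst (HasDegree (A D (suc n))) (≡.cong (3 +ℕ_) (≡.sym (ℕP.*-suc 2 n)))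
  (secondDerivative-degree D (A D n) (A-degree D n))

module IntegerImage {c ℓ} (R : CommutativeRing c ℓ) where

  open CommutativeRing R
  open import Algebra.Properties.Semiring.Mult semiring
    using (×-homo-+; ×1-homo-*) renaming (_×_ to _×ᴿ_)
  open import Algebra.Properties.Ring ring
    using (-0#≈0#; -‿involutive; -‿+-comm; -‿distribˡ-*; -‿distribʳ-*; //-rightDividesʳ)
  open import Algebra.Properties.CommutativeSemigroup +-commutativeSemigroup using (x∙yz≈y∙xz)
  open import Relation.Binary.Reasoning.Setoid setoid

  natR≡×1# : ∀ n → natR R n ≡ n ×ᴿ 1#
  natR≡×1# zero    = ≡.refl
  natR≡×1# (suc n) = ≡.cong (λ x → 1# + x) (natR≡×1# n)

  natR-homo-+ : ∀ m n → natR R (m +ℕ n) ≈ natR R m + natR R n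
  natR-homo-+ m n rewrite natR≡×1# (m +ℕ n) | natR≡×1# m | natR≡×1# n = ×-homo-+ 1# m n

  natR-homo-* : ∀ m n → natR R (m *ℕ n) ≈ natR R m * natR R n
  natR-homo-* m n rewrite natR≡×1# (m *ℕ n) | natR≡×1# m | natR≡×1# n = ×1-homo-* m n

  intR-homo-neg : ∀ i → intR R (ℤ.- i) ≈ - intR R i
  intR-homo-neg -[1+ n ]  = sym (-‿involutive _)
  intR-homo-neg (+ zero)  = sym -0#≈0#
  intR-homo-neg (+ suc n) = refl

  intR[m⊖n]+natR[n]≈natR[m] : ∀ m n → intR R (m ⊖ n) + natR R n ≈ natR R m
  intR[m⊖n]+natR[n]≈natR[m] m       zero    = +-identityʳ _
  intR[m⊖n]+natR[n]≈natR[m] zero    (suc n) = -‿inverseˡ _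
  intR[m⊖n]+natR[n]≈natR[m] (suc m) (suc n) rewrite ℤP.[1+m]⊖[1+n]≡m⊖n m n =
    trans (x∙yz≈y∙xz _ 1# _) (+-congˡ (intR[m⊖n]+natR[n]≈natR[m] m n))

  intR-homo-⊖ : ∀ m n → intR R (m ⊖ n) ≈ natR R m - natR R n
  intR-homo-⊖ m n = trans (sym (//-rightDividesʳ (natR R n) _)) (+-congʳ (intR[m⊖n]+natR[n]≈natR[m] m n))

  intR-homo-+ : ∀ i j → intR R (i ℤ.+ j) ≈ intR R i + intR R j
  intR-homo-+ (+ m)    (+ n)    = natR-homo-+ m n
  intR-homo-+ (+ m)    -[1+ n ] = intR-homo-⊖ m (suc n)
  intR-homo-+ -[1+ m ] (+ n)    = trans (intR-homo-⊖ n (suc m)) (+-comm _ _)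
  intR-homo-+ -[1+ m ] -[1+ n ] = begin
    - natR R (2 +ℕ (m +ℕ n))   ≡⟨ ≡.cong (λ k → - natR R (suc k)) (ℕP.+-suc m n) ⟨
    - natR R (suc m +ℕ suc n)  ≈⟨ -‿cong (natR-homo-+ (suc m) (suc n)) ⟩
    - (natR R (suc m) + natR R (suc n)) ≈⟨ -‿+-comm _ _ ⟨
    - natR R (suc m) + - natR R (suc n) ∎

  intR-homo-*-+ : ∀ m j → intR R (+ m ℤ.* j) ≈ natR R m * intR R j
  intR-homo-*-+ m (+ n)    = trans (reflexive (≡.cong (intR R) (≡.sym (ℤP.pos-* m n)))) (natR-homo-* m n)
  intR-homo-*-+ m -[1+ n ] = begin
    intR R (+ m ℤ.* ℤ.- + suc n)   ≡⟨ ≡.cong (intR R) (ℤP.neg-distribʳ-* (+ m) (+ suc n)) ⟨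
    intR R (ℤ.- (+ m ℤ.* + suc n)) ≈⟨ intR-homo-neg (+ m ℤ.* + suc n) ⟩
    - intR R (+ m ℤ.* + suc n)     ≈⟨ -‿cong (intR-homo-*-+ m (+ suc n)) ⟩
    - (natR R m * natR R (suc n))  ≈⟨ -‿distribʳ-* _ _ ⟩
    natR R m * - natR R (suc n)    ∎

  intR-homo-* : ∀ i j → intR R (i ℤ.* j) ≈ intR R i * intR R j
  intR-homo-* (+ m)    j = intR-homo-*-+ m j
  intR-homo-* -[1+ m ] j = begin
    intR R (ℤ.- + suc m ℤ.* j)     ≡⟨ ≡.cong (intR R) (ℤP.neg-distribˡ-* (+ suc m) j) ⟨
    intR R (ℤ.- (+ suc m ℤ.* j))   ≈⟨ intR-homo-neg (+ suc m ℤ.* j) ⟩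
    - intR R (+ suc m ℤ.* j)       ≈⟨ -‿cong (intR-homo-*-+ (suc m) j) ⟩
    - (natR R (suc m) * intR R j)  ≈⟨ -‿distribˡ-* _ _ ⟩
    - natR R (suc m) * intR R j    ∎

module Evaluation {c ℓ} (R : CommutativeRing c ℓ) (W : CommutativeRing.Carrier R) where

  open CommutativeRing R
  open IntegerImage R using (intR-homo-+; intR-homo-*)
  open import Algebra.Properties.CommutativeSemigroup +-commutativeSemigroup using (interchange)
  open import Algebra.Properties.CommutativeSemigroup *-commutativeSemigroup
    using () renaming (x∙yz≈y∙xz to x*yz≈y*xz)

  eval : Poly → Carrier
  eval P = evalPoly R P W

  eval-+ₚ : ∀ p q → eval (p +ₚ q) ≈ eval p + eval q
  eval-+ₚ []      q       = sym (+-identityˡ _)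
  eval-+ₚ (a ∷ p) []      = sym (+-identityʳ _)
  eval-+ₚ (a ∷ p) (b ∷ q) =
    trans (+-cong (intR-homo-+ a b) (trans (*-congˡ (eval-+ₚ p q)) (distribˡ W _ _))) (interchange _ _ _ _)

  eval-·ₚ : ∀ c p → eval (c ·ₚ p) ≈ intR R c * eval p
  eval-·ₚ c []      = sym (zeroʳ _)
  eval-·ₚ c (a ∷ p) =
    trans (+-cong (intR-homo-* c a) (trans (*-congˡ (eval-·ₚ c p)) (x*yz≈y*xz W _ _))) (sym (distribˡ _ _ _))

  eval-X^ : ∀ k p → eval (X^ k * p) ≈ iter k (W *_) (eval p)
  eval-X^ zero    p = refl
  eval-X^ (suc k) p = trans (+-identityˡ _) (*-congˡ (eval-X^ k p))

  eval-derivativeFrom-suc : ∀ k p → eval (derivativeFrom (suc k) p) ≈ eval p + eval (derivativeFrom k p)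
  eval-derivativeFrom-suc k []      = sym (+-identityʳ _)
  eval-derivativeFrom-suc k (a ∷ p) =
    trans (+-cong (trans (reflexive (≡.cong (intR R) (ℤP.suc-* (+ k) a))) (intR-homo-+ a _))
                  (trans (*-congˡ (eval-derivativeFrom-suc (suc k) p)) (distribˡ W _ _)))
          (interchange _ _ _ _)

  eval-derivativeFrom-0 : ∀ p → eval (derivativeFrom 0 p) ≈ W * eval (derivative p)
  eval-derivativeFrom-0 []      = sym (zeroʳ _)
  eval-derivativeFrom-0 (a ∷ p) = +-identityˡ _

  eval-derivative-∷ : ∀ a p → eval (derivative (a ∷ p)) ≈ eval p + W * eval (derivative p)
  eval-derivative-∷ a p = trans (eval-derivativeFrom-suc 0 p) (+-congˡ (eval-derivativeFrom-0 p))

module Derivation {c ℓ} (R : CommutativeRing c ℓ) (∂ : CommutativeRing.Carrier R → CommutativeRing.Carrier R)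
                  (∂-isDerivation : IsDerivation R ∂) where

  open CommutativeRing R
  open IsDerivation ∂-isDerivation
  open IntegerImage R using (intR-homo-neg)
  open import Algebra.Properties.Ring ring using (x+x≈x⇒x≈0; -0#≈0#; +-inverseˡ-unique)
  open import Algebra.Solver.Ring.NaturalCoefficients.Default commutativeSemiring
    using (solve; _:=_; _:+_; _:*_; con)
  open import Relation.Binary.Reasoning.Setoid setoid

  ∂-0# : ∂ 0# ≈ 0#
  ∂-0# = x+x≈x⇒x≈0 _ (trans (sym (∂-+ 0# 0#)) (∂-cong (+-identityʳ 0#)))

  ∂-1# : ∂ 1# ≈ 0#
  ∂-1# = x+x≈x⇒x≈0 _ (begin
    ∂ 1# + ∂ 1#            ≈⟨ +-cong (*-identityʳ _) (*-identityˡ _) ⟨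
    ∂ 1# * 1# + 1# * ∂ 1#  ≈⟨ ∂-leibniz 1# 1# ⟨
    ∂ (1# * 1#)            ≈⟨ ∂-cong (*-identityʳ 1#) ⟩
    ∂ 1#                   ∎)

  ∂-neg : ∀ x → ∂ (- x) ≈ - ∂ x
  ∂-neg x = +-inverseˡ-unique _ _ (trans (sym (∂-+ (- x) x)) (trans (∂-cong (-‿inverseˡ x)) ∂-0#))

  ∂-natR : ∀ n → ∂ (natR R n) ≈ 0#
  ∂-natR zero    = ∂-0#
  ∂-natR (suc n) = trans (∂-+ _ _) (trans (+-cong ∂-1# (∂-natR n)) (+-identityʳ 0#))

  ∂-intR : ∀ i → ∂ (intR R i) ≈ 0#
  ∂-intR (+ n)    = ∂-natR n
  ∂-intR -[1+ n ] = trans (∂-neg _) (trans (-‿cong (∂-natR (suc n))) -0#≈0#)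

  module _ {W V : Carrier} (∂W≈V : ∂ W ≈ V) where

    open Evaluation R W

    ∂-eval : ∀ P → ∂ (eval P) ≈ eval (derivative P) * V
    ∂-eval []      = trans ∂-0# (sym (zeroˡ V))
    ∂-eval (a ∷ p) = begin
      ∂ (intR R a + W * eval p)                         ≈⟨ ∂-+ _ _ ⟩
      ∂ (intR R a) + ∂ (W * eval p)                     ≈⟨ +-cong (∂-intR a) (∂-leibniz W (eval p)) ⟩
      0# + (∂ W * eval p + W * ∂ (eval p))              ≈⟨ +-identityˡ _ ⟩
      ∂ W * eval p + W * ∂ (eval p)                     ≈⟨ +-cong (*-congʳ ∂W≈V) (*-congˡ (∂-eval p)) ⟩
      V * eval p + W * (eval (derivative p) * V)        ≈⟨ rearrange V (eval p) W (eval (derivative p)) ⟩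
      (eval p + W * eval (derivative p)) * V            ≈⟨ *-congʳ (eval-derivative-∷ a p) ⟨
      eval (derivative (a ∷ p)) * V                     ∎
      where
      rearrange : ∀ v e w f → v * e + w * (f * v) ≈ (e + w * f) * v
      rearrange = solve 4 (λ v e w f → v :* e :+ w :* (f :* v) := (e :+ w :* f) :* v) refl

    module _ (D : ℤ) (∂V≈2W³ : ∂ V ≈ intR R (+ 2) * (W * (W * W)))
             (V²≈W⁴-D : V * V ≈ (W * W) * (W * W) - intR R D) where

      ∂²-eval : ∀ P → ∂ (∂ (eval P)) ≈ eval (secondDerivative D P)
      ∂²-eval P = begin
        ∂ (∂ (eval P))                                  ≈⟨ ∂-cong (∂-eval P) ⟩
        ∂ (eval P′ * V)                                 ≈⟨ ∂-leibniz _ _ ⟩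
        ∂ (eval P′) * V + eval P′ * ∂ V                 ≈⟨ +-cong (*-congʳ (∂-eval P′)) (*-congˡ ∂V≈2W³) ⟩
        eval P″ * V * V + eval P′ * (two * W³)          ≈⟨ +-congʳ (*-assoc _ _ _) ⟩
        eval P″ * (V * V) + eval P′ * (two * W³)        ≈⟨ +-congʳ (*-congˡ V²≈W⁴-D) ⟩
        eval P″ * (W⁴ - intR R D) + eval P′ * (two * W³)
          ≈⟨ rearrange (eval P″) (eval P′) W (- intR R D) two ⟩
        iter 4 (W *_) (eval P″) + (- intR R D * eval P″ + two * iter 3 (W *_) (eval P′))
          ≈⟨ +-cong (eval-X^ 4 P″) (+-cong (trans (eval-·ₚ (ℤ.- D) P″) (*-congʳ (intR-homo-neg D)))
                                            (trans (eval-·ₚ (+ 2) (X^ 3 * P′)) (*-congˡ (eval-X^ 3 P′)))) ⟨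
        eval (X^ 4 * P″) + (eval (ℤ.- D ·ₚ P″) + eval (+ 2 ·ₚ X^ 3 * P′))
          ≈⟨ trans (eval-+ₚ (X^ 4 * P″) (ℤ.- D ·ₚ P″ +ₚ + 2 ·ₚ X^ 3 * P′))
                  (+-congˡ (eval-+ₚ (ℤ.- D ·ₚ P″) (+ 2 ·ₚ X^ 3 * P′))) ⟨
        eval (secondDerivative D P)                     ∎
        where
        P′ P″ : Poly
        P′ = derivative P
        P″ = derivative P′
        two W³ W⁴ : Carrier
        two = intR R (+ 2)
        W³  = W * (W * W)
        W⁴  = (W * W) * (W * W)
        rearrange : ∀ a b w m t → a * ((w * w) * (w * w) + m) + b * (t * (w * (w * w)))
                                ≈ w * (w * (w * (w * a))) + (m * a + t * (w * (w * (w * b))))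
        rearrange = solve 5 (λ a b w m t →
          a :* ((w :* w) :* (w :* w) :+ m) :+ b :* (t :* (w :* (w :* w)))
            := w :* (w :* (w :* (w :* a))) :+ (m :* a :+ t :* (w :* (w :* (w :* b))))) refl

      iter-∂-V≈eval-A : ∀ n → iter (2 *ℕ n +ℕ 1) ∂ V ≈ eval (A D n)
      iter-∂-V≈eval-A zero    = trans ∂V≈2W³ (sym (trans (eval-X^ 3 (+ 2 ∷ [])) (W³-shape W (intR R (+ 2)))))
        where
        W³-shape : ∀ w t → w * (w * (w * (t + w * 0#))) ≈ t * (w * (w * w))
        W³-shape = solve 2 (λ w t → w :* (w :* (w :* (t :+ w :* con 0))) := t :* (w :* (w :* w))) refl
      iter-∂-V≈eval-A (suc n) = begin
        iter (2 *ℕ suc n +ℕ 1) ∂ V       ≡⟨ ≡.cong (λ k → iter (k +ℕ 1) ∂ V) (ℕP.*-suc 2 n) ⟩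
        ∂ (∂ (iter (2 *ℕ n +ℕ 1) ∂ V))  ≈⟨ ∂-cong (∂-cong (iter-∂-V≈eval-A n)) ⟩
        ∂ (∂ (eval (A D n)))              ≈⟨ ∂²-eval (A D n) ⟩
        eval (A D (suc n))                ∎

lemma4p3 : ∀ {c ℓ} (D : ℤ) → ¬ (D ≡ + 0) → (n : ℕ) →
    Σ Poly (λ A → HasDegree A (2 *ℕ n +ℕ 3) ×
      ((R : CommutativeRing c ℓ) → (∂ : CommutativeRing.Carrier R → CommutativeRing.Carrier R) →
        IsDerivation R ∂ → (W V : CommutativeRing.Carrier R) →
        let open CommutativeRing R in
        ∂ W ≈ V → ∂ V ≈ intR R (+ 2) * (W * (W * W)) →
        V * V ≈ (W * W) * (W * W) - intR R D →
        iter (2 *ℕ n +ℕ 1) ∂ V ≈ evalPoly R A W))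
lemma4p3 D _ n =
  A D n ,
  ≡.subst (HasDegree (A D n)) (ℕP.+-comm 3 (2 *ℕ n)) (A-degree D n) ,
  λ R ∂ ∂-isDerivation W V ∂W≈V ∂V≈2W³ V²≈W⁴-D →
    Derivation.iter-∂-V≈eval-A R ∂ ∂-isDerivation ∂W≈V D ∂V≈2W³ V²≈W⁴-D n
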